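{- Let $\mathcal P\subset\mathbb R^2$ be a set of $m$ points and $\mathcal Q\subset\mathbb R^2$ a set of $n$ points, and let $\mathcal L=\{\ell_{p,q}: p\in\mathcal P,q\in\mathcal Q\}\cup\{\ell_{q,p}:p\in\mathcal P,q\in\mathcal Q\}$. Then (i) every point of $\mathbb R^3$ is incident to at most $2m$ lines of $\mathcal L$; (ii) every plane in $\mathbb R^3$ contains at most $2m$ lines of $\mathcal L$.
   Context: For $p=(p_x,p_y),q=(q_x,q_y)\in\mathbb R^2$, $\ell_{p,q}\subset\mathbb R^3$ is the line $\left\{\left(\frac{p_x+q_x}{2},\frac{p_y+q_y}{2},0\right)+t\left(\frac{q_y-p_y}{2},\frac{p_x-q_x}{2},1\right): t\in\mathbb R\right\}$. (Under the identification of a rotation of $\mathbb R^2$ with center $(o_x,o_y)$ and counterclockwise angle $\alpha\in(0,2\pi)$ with the point $(o_x,o_y,\cot(\alpha/2))\in\mathbb R^3$, $\ell_{p,q}$ is the set of rotations taking $p$ to $q$.) -}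

module Defs where

open import Data.Nat using (ℕ)
open import Data.Fin using (Fin)
open import Data.Bool using (Bool; true; false)
open import Data.Product using (_×_; _,_; ∃; ∃-syntax)
open import Relation.Binary.PropositionalEquality using (_≡_; _≢_)
open import Relation.Nullary using (¬_)
open import Algebra.Structures using (IsCommutativeRing)
open import Data.Sum using (_⊎_)

-- An axiomatic model of the real numbers: a complete ordered field
-- (equality is propositional equality on the carrier).  Every model is
-- isomorphic to ℝ, so quantifying over all models = stating it for ℝ.
record RealField : Set₁ where
  infixl 6 _+_ _-_
  infixl 7 _*_
  infix 4 _≤_
  field
    Carrier : Set
    _+_ _*_ : Carrier → Carrier → Carrier
    -_ : Carrier → Carrier
    0# 1# : Carrier
    _≤_ : Carrier → Carrier → Set
    isCommutativeRing : IsCommutativeRing _≡_ _+_ _*_ -_ 0# 1#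
    0≢1 : 0# ≢ 1#
    inv : (x : Carrier) → x ≢ 0# → Carrier
    inv-inverse : (x : Carrier) (nz : x ≢ 0#) → x * inv x nz ≡ 1#
    -- (redundant for an ordered field, recorded for convenience)
    two≢0 : 1# + 1# ≢ 0#
    ≤-refl : ∀ {x} → x ≤ x
    ≤-trans : ∀ {x y z} → x ≤ y → y ≤ z → x ≤ z
    ≤-antisym : ∀ {x y} → x ≤ y → y ≤ x → x ≡ y
    ≤-total : ∀ x y → (x ≤ y) ⊎ (y ≤ x)
    +-mono-≤ : ∀ {x y} z → x ≤ y → x + z ≤ y + z
    *-nonneg : ∀ {x y} → 0# ≤ x → 0# ≤ y → 0# ≤ x * y
    sup : (S : Carrier → Set) → ∃ S → (∃[ b ] (∀ x → S x → x ≤ b)) →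
          ∃[ s ] ((∀ x → S x → x ≤ s) × (∀ b → (∀ x → S x → x ≤ b) → s ≤ b))

  _-_ : Carrier → Carrier → Carrier
  x - y = x + (- y)

  half : Carrier
  half = inv (1# + 1#) two≢0



module Geometry (R : RealField) where
  open RealField R

  Point2 : Set
  Point2 = Carrier × Carrier

  Point3 : Set
  Point3 = Carrier × Carrier × Carrier

  Line : Set₁
  Line = Point3 → Set

  ℓ : Point2 → Point2 → Line
  ℓ (px , py) (qx , qy) r =
    ∃[ t ] (r ≡ ( (px + qx) * half + t * ((qy - py) * half)
                , (py + qy) * half + t * ((px - qx) * half)
                , 0# + t * 1# ))

  SameLine : Line → Line → Set
  SameLine l₁ l₂ = ∀ r → (l₁ r → l₂ r) × (l₂ r → l₁ r)

  Label : ℕ → ℕ → Set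
  Label m n = Fin m × Fin n × Bool

  lineOf : ∀ {m n} → (Fin m → Point2) → (Fin n → Point2) → Label m n → Line
  lineOf P Q (i , j , true)  = ℓ (P i) (Q j)
  lineOf P Q (i , j , false) = ℓ (Q j) (P i)

  record Plane : Set where
    field
      a b c d : Carrier
      nondeg : ¬ ((a ≡ 0#) × (b ≡ 0#) × (c ≡ 0#))

  InPlane : Plane → Point3 → Set
  InPlane π (x , y , z) = a * x + b * y + c * z ≡ d
    where open Plane π

  LineInPlane : Line → Plane → Set
  LineInPlane l π = ∀ r → l r → InPlane π r

-- Give each line of 𝓛 the key (orientation, point of 𝓟); there are 2m keys, so by the
-- pigeonhole principle it suffices that two lines with the same key through a common point,
-- or in a common plane, coincide. For fixed p and height t, q ↦ ℓ_{p,q}(t) is a similarity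
-- of the plane (q − q' is moved by the matrix [[1, t], [−t, 1]] / 2), so for fixed p at most
-- one ℓ_{p,q} passes through a given point. Along ℓ_{p,q} the equation a x + b y + c z = d
-- of a plane is affine in t, and its intercept and slope depend on q through the similarity
-- [[a, b], [−b, a]] / 2, invertible since (a, b) ≠ 0 for a plane containing a non-horizontal
-- line; so for fixed p a plane contains at most one ℓ_{p,q}. The lines ℓ_{q,p} are the mirror
-- images of the ℓ_{p,q} in the plane z = 0.
module Submission where

open import Defs
open import Data.Nat using (ℕ; _≤_; _*_)
open import Data.Fin using (Fin)
open import Data.Product using (_×_)
open import Data.List using (List; length)
open import Data.List.Relation.Unary.All using (All)
open import Data.List.Relation.Unary.AllPairs using (AllPairs)
open import Relation.Binary.PropositionalEquality using (_≡_)
open import Relation.Nullary using (¬_)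
open import Function.Definitions using (Injective)

open import Algebra.Bundles using (CommutativeRing; RawRing)
import Algebra.Properties.CommutativeSemigroup
import Algebra.Properties.Ring
import Algebra.Properties.Semiring.Mult
import Algebra.Solver.Ring
open import Algebra.Solver.Ring.AlmostCommutativeRing using (_-Raw-AlmostCommutative⟶_; fromCommutativeRing)
open import Data.Bool using (Bool; true; false)
import Data.Fin as F
open import Data.Fin.Properties using (2↔Bool; pigeonhole; combine-injective)
open import Data.List using (lookup)
open import Data.List.Membership.Propositional.Properties using (∈-lookup)
import Data.List.Relation.Unary.All as All
open import Data.List.Relation.Unary.AllPairs as AllPairs using (_∷_)
open import Data.Maybe using (Maybe; just; nothing)
import Data.Nat as ℕ
open import Data.Nat using (zero; suc; s≤s)
import Data.Nat.Properties as ℕₚ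
open import Data.Product using (_,_; proj₁; proj₂)
open import Data.Product.Properties using (,-injectiveˡ; ,-injectiveʳ)
open import Data.Sum using (inj₁; inj₂)
open import Function using (_∘_; id)
open import Function.Bundles using (Injection; _↣_)
open import Function.Properties.Inverse using (↔-sym; ↔⇒↣)
open import Relation.Binary.PropositionalEquality as ≡
  using (_≢_; refl; sym; trans; cong; cong₂; subst; subst₂; module ≡-Reasoning)
import Relation.Binary.Reasoning.Setoid
open import Relation.Nullary using (yes; no; contradiction)

AllPairs-lookup : ∀ {A : Set} {R : A → A → Set} {xs : List A} → AllPairs R xs →
                  ∀ {i j} → i F.< j → R (lookup xs i) (lookup xs j)
AllPairs-lookup (Rx ∷ _)  {F.zero}  {F.suc j} _         = All.lookup Rx (∈-lookup j)
AllPairs-lookup (_ ∷ Rxs) {F.suc _} {F.suc _} (s≤s i<j) = AllPairs-lookup Rxs i<j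

injectiveOn⇒length≤ : ∀ {A : Set} {P : A → Set} {k} (f : A → Fin k) →
  (∀ {u v} → P u → P v → f u ≡ f v → u ≡ v) →
  ∀ {xs} → All P xs → AllPairs _≢_ xs → length xs ≤ k
injectiveOn⇒length≤ {k = k} f injective {xs} Pxs distinct with length xs ℕ.≤? k
... | yes xs≤k = xs≤k
... | no  xs≰k with i , j , i<j , fi≡fj ← pigeonhole (ℕₚ.≰⇒> xs≰k) (f ∘ lookup xs) =
  contradiction (injective (All.lookup Pxs (∈-lookup i)) (All.lookup Pxs (∈-lookup j)) fi≡fj)
                (AllPairs-lookup distinct i<j)

-- The coefficients are integers written as differences a − b of naturals,
-- kept normalised (one of a, b is zero) so that the solver can recognise
-- equal coefficients syntactically.
module DifferenceCoefficientSolver {c ℓ} (R : CommutativeRing c ℓ) where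

  private
    open CommutativeRing R
      using ( Carrier; _≈_; _+_; -_; _-_; 0#; 1#; setoid; ring; semiring; +-commutativeSemigroup
            ; +-cong; +-congˡ; +-congʳ; -‿cong; distribʳ; +-identityˡ; +-identityʳ; -‿inverseʳ )
      renaming (_*_ to _·_; refl to ≈-refl; sym to ≈-sym; trans to ≈-trans)
    open Algebra.Properties.Ring ring using (-‿distribˡ-*; x[y-z]≈xy-xz; -‿+-comm; ⁻¹-anti-homo‿-; -0#≈0#)
    open Algebra.Properties.Semiring.Mult semiring renaming (_×_ to _×ᵣ_) using (×-homo-+; ×1-homo-*)
    open Algebra.Properties.CommutativeSemigroup +-commutativeSemigroup using (interchange)
    open Relation.Binary.Reasoning.Setoid setoid

    normalise : ℕ → ℕ → ℕ × ℕ
    normalise zero    b       = zero , b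
    normalise (suc a) zero    = suc a , zero
    normalise (suc a) (suc b) = normalise a b

    Coefficients : RawRing _ _
    Coefficients = record
      { Carrier = ℕ × ℕ ; _≈_ = _≡_
      ; _+_ = λ { (a , b) (c , d) → normalise (a ℕ.+ c) (b ℕ.+ d) }
      ; _*_ = λ { (a , b) (c , d) → normalise (a ℕ.* c ℕ.+ b ℕ.* d) (a ℕ.* d ℕ.+ b ℕ.* c) }
      ; -_ = λ { (a , b) → b , a }
      ; 0# = 0 , 0 ; 1# = 1 , 0
      }

    ⟦_⟧ : ℕ × ℕ → Carrier
    ⟦ a , b ⟧ = a ×ᵣ 1# - b ×ᵣ 1#

    sum-of-differences : ∀ x z y w → (x + z) - (y + w) ≈ (x - y) + (z - w)
    sum-of-differences x z y w = begin
      (x + z) + - (y + w)    ≈⟨ +-congˡ (-‿+-comm y w) ⟨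
      (x + z) + (- y + - w)  ≈⟨ interchange x z (- y) (- w) ⟩
      (x - y) + (z - w)      ∎

    product-of-differences : ∀ x y z w → (x · z + y · w) - (x · w + y · z) ≈ (x - y) · (z - w)
    product-of-differences x y z w = ≈-sym (begin
      (x - y) · (z - w)                         ≈⟨ distribʳ (z - w) x (- y) ⟩
      x · (z - w) + - y · (z - w)               ≈⟨ +-congˡ (-‿distribˡ-* y (z - w)) ⟨
      x · (z - w) + - (y · (z - w))             ≈⟨ +-cong (x[y-z]≈xy-xz x z w) (-‿cong (x[y-z]≈xy-xz y z w)) ⟩
      (x · z - x · w) + - (y · z - y · w)       ≈⟨ +-congˡ (⁻¹-anti-homo‿- (y · z) (y · w)) ⟩
      (x · z - x · w) + (y · w - y · z)         ≈⟨ interchange _ _ _ _ ⟩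
      (x · z + y · w) + (- (x · w) + - (y · z)) ≈⟨ +-congˡ (-‿+-comm _ _) ⟩
      (x · z + y · w) - (x · w + y · z)         ∎)

    ⟦normalise⟧ : ∀ a b → ⟦ normalise a b ⟧ ≈ ⟦ a , b ⟧
    ⟦normalise⟧ zero    b       = ≈-refl
    ⟦normalise⟧ (suc a) zero    = ≈-refl
    ⟦normalise⟧ (suc a) (suc b) = begin
      ⟦ normalise a b ⟧                  ≈⟨ ⟦normalise⟧ a b ⟩
      a ×ᵣ 1# - b ×ᵣ 1#                  ≈⟨ +-identityˡ _ ⟨
      0# + (a ×ᵣ 1# - b ×ᵣ 1#)           ≈⟨ +-congʳ (-‿inverseʳ 1#) ⟨
      (1# - 1#) + (a ×ᵣ 1# - b ×ᵣ 1#)    ≈⟨ sum-of-differences 1# (a ×ᵣ 1#) 1# (b ×ᵣ 1#) ⟨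
      suc a ×ᵣ 1# - suc b ×ᵣ 1#          ∎

    ×1-homo-+ : ∀ m n → (m ℕ.+ n) ×ᵣ 1# ≈ m ×ᵣ 1# + n ×ᵣ 1#
    ×1-homo-+ = ×-homo-+ 1#

    homomorphism : Coefficients -Raw-AlmostCommutative⟶ fromCommutativeRing R
    homomorphism = record
      { ⟦_⟧    = ⟦_⟧
      ; +-homo = λ { (a , b) (c , d) → begin
          ⟦ normalise (a ℕ.+ c) (b ℕ.+ d) ⟧          ≈⟨ ⟦normalise⟧ (a ℕ.+ c) (b ℕ.+ d) ⟩
          (a ℕ.+ c) ×ᵣ 1# - (b ℕ.+ d) ×ᵣ 1#          ≈⟨ +-cong (×1-homo-+ a c) (-‿cong (×1-homo-+ b d)) ⟩
          (a ×ᵣ 1# + c ×ᵣ 1#) - (b ×ᵣ 1# + d ×ᵣ 1#)  ≈⟨ sum-of-differences _ _ _ _ ⟩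
          ⟦ a , b ⟧ + ⟦ c , d ⟧                      ∎ }
      ; *-homo = λ { (a , b) (c , d) → begin
          ⟦ normalise (a ℕ.* c ℕ.+ b ℕ.* d) (a ℕ.* d ℕ.+ b ℕ.* c) ⟧
            ≈⟨ ⟦normalise⟧ (a ℕ.* c ℕ.+ b ℕ.* d) (a ℕ.* d ℕ.+ b ℕ.* c) ⟩
          (a ℕ.* c ℕ.+ b ℕ.* d) ×ᵣ 1# - (a ℕ.* d ℕ.+ b ℕ.* c) ×ᵣ 1#
            ≈⟨ +-cong (≈-trans (×1-homo-+ (a ℕ.* c) (b ℕ.* d)) (+-cong (×1-homo-* a c) (×1-homo-* b d)))
                      (-‿cong (≈-trans (×1-homo-+ (a ℕ.* d) (b ℕ.* c)) (+-cong (×1-homo-* a d) (×1-homo-* b c)))) ⟩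
          (a ×ᵣ 1# · c ×ᵣ 1# + b ×ᵣ 1# · d ×ᵣ 1#) - (a ×ᵣ 1# · d ×ᵣ 1# + b ×ᵣ 1# · c ×ᵣ 1#)
            ≈⟨ product-of-differences _ _ _ _ ⟩
          ⟦ a , b ⟧ · ⟦ c , d ⟧ ∎ }
      ; -‿homo = λ { (a , b) → ≈-sym (⁻¹-anti-homo‿- (a ×ᵣ 1#) (b ×ᵣ 1#)) }
      ; 0-homo = ≈-trans (+-congˡ -0#≈0#) (+-identityʳ 0#)
      ; 1-homo = ≈-trans (+-cong (+-identityʳ 1#) -0#≈0#) (+-identityʳ 1#)
      }

    _≟ᶜ_ : ∀ x y → Maybe (⟦ x ⟧ ≈ ⟦ y ⟧)
    (a , b) ≟ᶜ (c , d) with a ℕ.≟ c | b ℕ.≟ d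
    ... | yes ≡.refl | yes ≡.refl = just ≈-refl
    ... | _          | _          = nothing

  open Algebra.Solver.Ring Coefficients (fromCommutativeRing R) homomorphism _≟ᶜ_ public

module OrderedField (R : RealField) where
  open RealField R renaming (_*_ to _·_; _≤_ to _≤ᵣ_)

  commutativeRing : CommutativeRing _ _
  commutativeRing = record { isCommutativeRing = isCommutativeRing }

  open CommutativeRing commutativeRing
    using (+-identityˡ; +-identityʳ; *-identityˡ; zeroˡ; zeroʳ; +-comm; -‿inverseʳ)
  open DifferenceCoefficientSolver commutativeRing using (solve; _:=_; _:+_; _:*_; _:-_; :-_)

  combination-zero : ∀ α β {e₁ e₂} → e₁ ≡ 0# → e₂ ≡ 0# → α · e₁ + β · e₂ ≡ 0#
  combination-zero α β refl refl = trans (cong₂ _+_ (zeroʳ α) (zeroʳ β)) (+-identityʳ 0#)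

  *-cancelˡ-≢0 : ∀ {a b} → a ≢ 0# → a · b ≡ 0# → b ≡ 0#
  *-cancelˡ-≢0 {a} {b} a≢0 ab≡0 = begin
    b                       ≡⟨ *-identityˡ b ⟨
    1# · b                  ≡⟨ cong (_· b) (inv-inverse a a≢0) ⟨
    (a · inv a a≢0) · b     ≡⟨ solve 3 (λ a a⁻¹ b → (a :* a⁻¹) :* b := a⁻¹ :* (a :* b)) refl a (inv a a≢0) b ⟩
    inv a a≢0 · (a · b)     ≡⟨ cong (inv a a≢0 ·_) ab≡0 ⟩
    inv a a≢0 · 0#          ≡⟨ zeroʳ _ ⟩
    0#                      ∎
    where open ≡-Reasoning

  half≢0 : half ≢ 0#
  half≢0 half≡0 = 0≢1 (begin
    0#                 ≡⟨ zeroʳ (1# + 1#) ⟨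
    (1# + 1#) · 0#     ≡⟨ cong ((1# + 1#) ·_) half≡0 ⟨
    (1# + 1#) · half   ≡⟨ inv-inverse (1# + 1#) two≢0 ⟩
    1#                 ∎)
    where open ≡-Reasoning

  0≤x·x : ∀ x → 0# ≤ᵣ x · x
  0≤x·x x with ≤-total 0# x
  ... | inj₁ 0≤x = *-nonneg 0≤x 0≤x
  ... | inj₂ x≤0 =
    subst (0# ≤ᵣ_) (solve 1 (λ x → (:- x) :* (:- x) := x :* x) refl x) (*-nonneg 0≤-x 0≤-x)
    where
    0≤-x : 0# ≤ᵣ - x
    0≤-x = subst₂ _≤ᵣ_ (-‿inverseʳ x) (+-identityˡ (- x)) (+-mono-≤ (- x) x≤0)

  x·x+y·y≡0⇒x·x≡0 : ∀ x y → x · x + y · y ≡ 0# → x · x ≡ 0#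
  x·x+y·y≡0⇒x·x≡0 x y sum≡0 = ≤-antisym x·x≤0 (0≤x·x x)
    where
    x·x≤0 : x · x ≤ᵣ 0#
    x·x≤0 = subst₂ _≤ᵣ_ (+-identityˡ (x · x)) (trans (+-comm _ _) sum≡0) (+-mono-≤ (x · x) (0≤x·x y))

  -- Constructively a vanishing square only makes its root ¬¬-zero, which suffices here.
  sum-of-squares≢0 : ∀ x y → ¬ (x ≡ 0# × y ≡ 0#) → x · x + y · y ≢ 0#
  sum-of-squares≢0 x y ¬both sum≡0 =
    ¬¬zero x (x·x+y·y≡0⇒x·x≡0 x y sum≡0) λ x≡0 →
    ¬¬zero y (x·x+y·y≡0⇒x·x≡0 y x (trans (+-comm _ _) sum≡0)) λ y≡0 →
    ¬both (x≡0 , y≡0)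
    where
    ¬¬zero : ∀ z → z · z ≡ 0# → ¬ ¬ (z ≡ 0#)
    ¬¬zero z z·z≡0 z≢0 = z≢0 (*-cancelˡ-≢0 z≢0 z·z≡0)

  -- (u , v) ↦ (α u + β v , α v − β u) is multiplication of u + i v by α − i β.
  rotation-scaling-kernel : ∀ {α β u v} → ¬ (α ≡ 0# × β ≡ 0#) →
    α · u + β · v ≡ 0# → α · v - β · u ≡ 0# → u ≡ 0# × v ≡ 0#
  rotation-scaling-kernel {α} {β} {u} {v} nonzero e₁ e₂ =
      *-cancelˡ-≢0 norm≢0 (trans (solve 4 (λ α β u v →
        (α :* α :+ β :* β) :* u := α :* (α :* u :+ β :* v) :+ (:- β) :* (α :* v :- β :* u)) refl α β u v)
        (combination-zero α (- β) e₁ e₂))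
    , *-cancelˡ-≢0 norm≢0 (trans (solve 4 (λ α β u v →
        (α :* α :+ β :* β) :* v := β :* (α :* u :+ β :* v) :+ α :* (α :* v :- β :* u)) refl α β u v)
        (combination-zero β α e₁ e₂))
    where
    norm≢0 : α · α + β · β ≢ 0#
    norm≢0 = sum-of-squares≢0 α β nonzero

  rotation-scaling-kernel₁ : ∀ {t u v} → u + t · v ≡ 0# → v - t · u ≡ 0# → u ≡ 0# × v ≡ 0#
  rotation-scaling-kernel₁ e₁ e₂ =
    rotation-scaling-kernel 1≢0 (trans (cong (_+ _) (*-identityˡ _)) e₁)
                                (trans (cong (_- _) (*-identityˡ _)) e₂)
    where
    1≢0 : ∀ {β} → ¬ (1# ≡ 0# × β ≡ 0#)
    1≢0 (1≡0 , _) = 0≢1 (sym 1≡0)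

  affine-zero : ∀ {u v} → (∀ t → u + t · v ≡ 0#) → u ≡ 0# × v ≡ 0#
  affine-zero {u} {v} vanishes = u≡0 , v≡0
    where
    u≡0 : u ≡ 0#
    u≡0 = trans (sym (trans (cong (u +_) (zeroˡ v)) (+-identityʳ u))) (vanishes 0#)
    v≡0 : v ≡ 0#
    v≡0 = trans (sym (trans (cong₂ _+_ u≡0 (*-identityˡ v)) (+-identityˡ v))) (vanishes 1#)

module LinesOfRotations (R : RealField) where
  open RealField R renaming (_*_ to _·_)
  open Geometry R
  open OrderedField R
  open CommutativeRing commutativeRing using (+-identityˡ; +-identityʳ; *-identityʳ; zeroˡ; +-congˡ; ring)
  open Algebra.Properties.Ring ring
    using (x∙y⁻¹≈ε⇒x≈y; x≈y⇒x∙y⁻¹≈ε; -‿distribˡ-*; -‿distribʳ-*; -‿injective; -0#≈0#)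
  open DifferenceCoefficientSolver commutativeRing using (solve; _:=_; _:+_; _:*_; _:-_; :-_)

  pointAt : Point2 → Point2 → Carrier → Point3
  pointAt (px , py) (qx , qy) t =
    ( (px + qx) · half + t · ((qy - py) · half)
    , (py + qy) · half + t · ((px - qx) · half)
    , 0# + t · 1# )

  ℓ-pointAt : ∀ p q t → ℓ p q (pointAt p q t)
  ℓ-pointAt (_ , _) (_ , _) t = t , refl

  0+t·1≡t : ∀ t → 0# + t · 1# ≡ t
  0+t·1≡t t = trans (+-identityˡ _) (*-identityʳ t)

  differences-zero⇒≡ : ∀ {qx qy q'x q'y} → qx - q'x ≡ 0# × qy - q'y ≡ 0# → (qx , qy) ≡ (q'x , q'y)
  differences-zero⇒≡ (dx≡0 , dy≡0) = cong₂ _,_ (x∙y⁻¹≈ε⇒x≈y _ _ dx≡0) (x∙y⁻¹≈ε⇒x≈y _ _ dy≡0)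

  half-cancel : ∀ {u} → half · u ≡ 0# → u ≡ 0#
  half-cancel = *-cancelˡ-≢0 half≢0

  common-point⇒same-target : ∀ r p q q' → ℓ p q r → ℓ p q' r → q ≡ q'
  common-point⇒same-target _ (px , py) (qx , qy) (q'x , q'y) (t , refl) (t' , same)
    with refl ← trans (sym (0+t·1≡t t)) (trans (,-injectiveʳ (,-injectiveʳ same)) (0+t·1≡t t'))
    = differences-zero⇒≡ (rotation-scaling-kernel₁ (half-cancel Δx≡0) (half-cancel Δy≡0))
    where
    Δx≡0 : half · ((qx - q'x) + t · (qy - q'y)) ≡ 0#
    Δx≡0 = trans
      (solve 8 (λ px py qx qy q'x q'y t h →
         h :* ((qx :- q'x) :+ t :* (qy :- q'y))
           := ((px :+ qx) :* h :+ t :* ((qy :- py) :* h)) :- ((px :+ q'x) :* h :+ t :* ((q'y :- py) :* h)))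
         refl px py qx qy q'x q'y t half)
      (x≈y⇒x∙y⁻¹≈ε (,-injectiveˡ same))
    Δy≡0 : half · ((qy - q'y) - t · (qx - q'x)) ≡ 0#
    Δy≡0 = trans
      (solve 8 (λ px py qx qy q'x q'y t h →
         h :* ((qy :- q'y) :- t :* (qx :- q'x))
           := ((py :+ qy) :* h :+ t :* ((px :- qx) :* h)) :- ((py :+ q'y) :* h :+ t :* ((px :- q'x) :* h)))
         refl px py qx qy q'x q'y t half)
      (x≈y⇒x∙y⁻¹≈ε (,-injectiveˡ (,-injectiveʳ same)))

  planeIntercept planeSlope : Plane → Point2 → Point2 → Carrier
  planeIntercept π (px , py) (qx , qy) = a · ((px + qx) · half) + b · ((py + qy) · half) - d
    where open Plane π
  planeSlope π (px , py) (qx , qy) = a · ((qy - py) · half) + b · ((px - qx) · half) + c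
    where open Plane π

  ℓ-in-plane⇒intercept≡0×slope≡0 : ∀ π p q → LineInPlane (ℓ p q) π →
                                   planeIntercept π p q ≡ 0# × planeSlope π p q ≡ 0#
  ℓ-in-plane⇒intercept≡0×slope≡0 π (px , py) (qx , qy) inπ = affine-zero λ t →
    trans (solve 10 (λ a b c d px py qx qy t h →
             (a :* ((px :+ qx) :* h) :+ b :* ((py :+ qy) :* h) :- d)
               :+ t :* (a :* ((qy :- py) :* h) :+ b :* ((px :- qx) :* h) :+ c)
             := (a :* ((px :+ qx) :* h :+ t :* ((qy :- py) :* h)) :+ b :* ((py :+ qy) :* h :+ t :* ((px :- qx) :* h))
                   :+ c :* t) :- d)
             refl a b c d px py qx qy t half)
          (x≈y⇒x∙y⁻¹≈ε (trans (+-congˡ (cong (c ·_) (sym (0+t·1≡t t))))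
                              (inπ _ (ℓ-pointAt (px , py) (qx , qy) t))))
    where open Plane π

  ℓ-in-plane⇒not-horizontal : ∀ π p q → LineInPlane (ℓ p q) π → ¬ (Plane.a π ≡ 0# × Plane.b π ≡ 0#)
  ℓ-in-plane⇒not-horizontal π@record { c = c ; nondeg = nondeg } p@(_ , _) q@(_ , _) inπ (refl , refl) =
    nondeg (refl , refl , c≡0)
    where
    c≡0 : c ≡ 0#
    c≡0 = begin
      c                  ≡⟨ +-identityˡ c ⟨
      0# + c             ≡⟨ cong (_+ c) (+-identityʳ 0#) ⟨
      0# + 0# + c        ≡⟨ cong₂ (λ u v → u + v + c) (zeroˡ _) (zeroˡ _) ⟨
      planeSlope π p q   ≡⟨ proj₂ (ℓ-in-plane⇒intercept≡0×slope≡0 π p q inπ) ⟩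
      0#                 ∎
      where open ≡-Reasoning

  common-plane⇒same-target : ∀ π p q q' → LineInPlane (ℓ p q) π → LineInPlane (ℓ p q') π → q ≡ q'
  common-plane⇒same-target π (px , py) (qx , qy) (q'x , q'y) inπ inπ' =
    differences-zero⇒≡ (rotation-scaling-kernel (ℓ-in-plane⇒not-horizontal π _ _ inπ)
      (half-cancel Δintercept≡0) (half-cancel Δslope≡0))
    where
    open Plane π
    on-q : planeIntercept π (px , py) (qx , qy) ≡ 0# × planeSlope π (px , py) (qx , qy) ≡ 0#
    on-q = ℓ-in-plane⇒intercept≡0×slope≡0 π (px , py) (qx , qy) inπ
    on-q' : planeIntercept π (px , py) (q'x , q'y) ≡ 0# × planeSlope π (px , py) (q'x , q'y) ≡ 0#
    on-q' = ℓ-in-plane⇒intercept≡0×slope≡0 π (px , py) (q'x , q'y) inπ'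
    Δintercept≡0 : half · (a · (qx - q'x) + b · (qy - q'y)) ≡ 0#
    Δintercept≡0 = trans
      (solve 10 (λ a b d px py qx qy q'x q'y h →
         h :* (a :* (qx :- q'x) :+ b :* (qy :- q'y))
           := (a :* ((px :+ qx) :* h) :+ b :* ((py :+ qy) :* h) :- d)
                :- (a :* ((px :+ q'x) :* h) :+ b :* ((py :+ q'y) :* h) :- d))
         refl a b d px py qx qy q'x q'y half)
      (x≈y⇒x∙y⁻¹≈ε (trans (proj₁ on-q) (sym (proj₁ on-q'))))
    Δslope≡0 : half · (a · (qy - q'y) - b · (qx - q'x)) ≡ 0#
    Δslope≡0 = trans
      (solve 10 (λ a b c px py qx qy q'x q'y h →
         h :* (a :* (qy :- q'y) :- b :* (qx :- q'x))
           := (a :* ((qy :- py) :* h) :+ b :* ((px :- qx) :* h) :+ c)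
                :- (a :* ((q'y :- py) :* h) :+ b :* ((px :- q'x) :* h) :+ c))
         refl a b c px py qx qy q'x q'y half)
      (x≈y⇒x∙y⁻¹≈ε (trans (proj₂ on-q) (sym (proj₂ on-q'))))

  reflect : Point3 → Point3
  reflect (x , y , z) = x , y , - z

  reflectPlane : Plane → Plane
  reflectPlane π = record
    { a = a ; b = b ; c = - c ; d = d
    ; nondeg = λ (a≡0 , b≡0 , -c≡0) → nondeg (a≡0 , b≡0 , -‿injective (trans -c≡0 (sym -0#≈0#)))
    }
    where open Plane π

  ℓ-reflect : ∀ p q {r} → ℓ q p r → ℓ p q (reflect r)
  ℓ-reflect (px , py) (qx , qy) (t , refl) = - t ,
    cong₂ _,_
      (solve 6 (λ px py qx qy t h →
         (qx :+ px) :* h :+ t :* ((py :- qy) :* h) := (px :+ qx) :* h :+ (:- t) :* ((qy :- py) :* h))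
         refl px py qx qy t half)
      (cong₂ _,_
        (solve 6 (λ px py qx qy t h →
           (qy :+ py) :* h :+ t :* ((qx :- px) :* h) := (py :+ qy) :* h :+ (:- t) :* ((px :- qx) :* h))
           refl px py qx qy t half)
        (trans (cong -_ (0+t·1≡t t)) (sym (0+t·1≡t (- t)))))

  LineInPlane-reflect : ∀ π p q → LineInPlane (ℓ q p) π → LineInPlane (ℓ p q) (reflectPlane π)
  LineInPlane-reflect π p q inπ (x , y , z) on =
    trans (+-congˡ (trans (sym (-‿distribˡ-* c z)) (-‿distribʳ-* c z))) (inπ _ (ℓ-reflect q p on))
    where open Plane π

  common-point⇒same-source : ∀ r p q q' → ℓ q p r → ℓ q' p r → q ≡ q'
  common-point⇒same-source r p q q' on on' =
    common-point⇒same-target (reflect r) p q q' (ℓ-reflect p q on) (ℓ-reflect p q' on')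

  common-plane⇒same-source : ∀ π p q q' → LineInPlane (ℓ q p) π → LineInPlane (ℓ q' p) π → q ≡ q'
  common-plane⇒same-source π p q q' inπ inπ' =
    common-plane⇒same-target (reflectPlane π) p q q'
      (LineInPlane-reflect π p q inπ) (LineInPlane-reflect π p q' inπ')

module Labels (R : RealField) {m n} (P : Fin m → Geometry.Point2 R) (Q : Fin n → Geometry.Point2 R)
              (Q-injective : Injective _≡_ _≡_ Q) where
  open Geometry R

  orientation : Bool ↣ Fin 2
  orientation = ↔⇒↣ (↔-sym 2↔Bool)

  key : Label m n → Fin (2 * m)
  key (i , _ , b) = F.combine (Injection.to orientation b) i

  key-injectiveOn : (Inc : Line → Set) →
    (∀ p q q' → Inc (ℓ p q) → Inc (ℓ p q') → q ≡ q') →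
    (∀ p q q' → Inc (ℓ q p) → Inc (ℓ q' p) → q ≡ q') →
    ∀ {u v} → Inc (lineOf P Q u) → Inc (lineOf P Q v) → key u ≡ key v → u ≡ v
  key-injectiveOn Inc same-target same-source {i , j , b} {i' , j' , b'} Inc-u Inc-v key≡
    with b≡b' , refl ← combine-injective _ i _ i' key≡
    with refl ← Injection.injective orientation {b} {b'} b≡b'
    = cong (λ j → i , j , b) (Q-injective (same-Q b Inc-u Inc-v))
    where
    same-Q : ∀ b → Inc (lineOf P Q (i , j , b)) → Inc (lineOf P Q (i , j' , b)) → Q j ≡ Q j'
    same-Q true  = same-target (P i) (Q j) (Q j')
    same-Q false = same-source (P i) (Q j) (Q j')

  distinct-lines-≤ : (Inc : Line → Set) →
    (∀ p q q' → Inc (ℓ p q) → Inc (ℓ p q') → q ≡ q') →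
    (∀ p q q' → Inc (ℓ q p) → Inc (ℓ q' p) → q ≡ q') →
    (L : List (Label m n)) →
    AllPairs (λ u v → ¬ SameLine (lineOf P Q u) (lineOf P Q v)) L →
    All (λ u → Inc (lineOf P Q u)) L →
    length L ≤ 2 * m
  distinct-lines-≤ Inc same-target same-source L distinct incident =
    injectiveOn⇒length≤ key (key-injectiveOn Inc same-target same-source) incident
      (AllPairs.map distinct-labels distinct)
    where
    distinct-labels : ∀ {u v} → ¬ SameLine (lineOf P Q u) (lineOf P Q v) → u ≢ v
    distinct-labels different refl = different λ _ → id , id

lemma4p7 : (R : RealField) → let open Geometry R in
    (m n : ℕ) (P : Fin m → Point2) (Q : Fin n → Point2) →
    Injective _≡_ _≡_ P → Injective _≡_ _≡_ Q →
    -- (i) any family of pairwise distinct lines of 𝓛 through a point has ≤ 2m members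
    ((x : Point3) (L : List (Label m n)) →
      AllPairs (λ u v → ¬ SameLine (lineOf P Q u) (lineOf P Q v)) L →
      All (λ u → lineOf P Q u x) L →
      length L ≤ 2 * m)
    ×
    -- (ii) any family of pairwise distinct lines of 𝓛 in a plane has ≤ 2m members
    ((π : Plane) (L : List (Label m n)) →
      AllPairs (λ u v → ¬ SameLine (lineOf P Q u) (lineOf P Q v)) L →
      All (λ u → LineInPlane (lineOf P Q u) π) L →
      length L ≤ 2 * m)
lemma4p7 R m n P Q _ Q-injective =
    (λ x → distinct-lines-≤ (λ l → l x) (common-point⇒same-target x) (common-point⇒same-source x))
  , (λ π → distinct-lines-≤ (λ l → LineInPlane l π)
                             (common-plane⇒same-target π) (common-plane⇒same-source π))
  where
  open Geometry R
  open LinesOfRotations R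
  open Labels R P Q Q-injective
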